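{- Let $\ell\ge 1$ and define recursively $(a_0,b_0)=(\ell+1,2\ell+2)$ and, for $n\ge 1$, $a_n=\mathrm{mex}(\{a_i,b_i: i<n\}\cup\{0,1,\dots,\ell\})$, $b_n=a_n+n+\ell+1$. Then: (1) the sequences $(a_n)_{n\ge0}$ and $(b_n)_{n\ge0}$ are strictly increasing; (2) the sets $\{a_n:n\ge0\}$ and $\{b_n:n\ge0\}$ form a partition of $\{m\in\mathbb{N}: m>\ell\}$; (3) for each integer $j>\ell$ there exists a unique $n$ such that $j=b_n-a_n$; (4) for all $n$, $a_{n+1}-a_n\in\{1,2\}$ and $b_{n+1}-b_n\in\{2,3\}$; in particular $b_{n+1}-b_n=a_{n+1}-a_n+1$.
   Context: $\mathrm{mex}\,S=\min(\mathbb{N}\setminus S)$. -}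

module Defs where

open import Data.Nat using (ℕ; zero; suc; _+_; _∸_; _≤_; _<_)
open import Data.Product using (Σ; _×_; ∃; ∃-syntax)
open import Data.Sum using (_⊎_)
open import Relation.Nullary using (¬_)
open import Relation.Binary.PropositionalEquality using (_≡_)

IsMex : (ℕ → Set) → ℕ → Set
IsMex S m = ¬ S m × (∀ k → k < m → S k)

Prev : ℕ → (ℕ → ℕ) → (ℕ → ℕ) → ℕ → ℕ → Set
Prev ℓ a b n m = (Σ ℕ λ i → i < n × (m ≡ a i ⊎ m ≡ b i)) ⊎ m ≤ ℓ

IsSeq : ℕ → (ℕ → ℕ) → (ℕ → ℕ) → Set
IsSeq ℓ a b =
  a 0 ≡ ℓ + 1 × b 0 ≡ 2 Data.Nat.* ℓ + 2 ×
  (∀ n → IsMex (Prev ℓ a b (suc n)) (a (suc n))) ×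
  (∀ n → b (suc n) ≡ a (suc n) + suc n + ℓ + 1)

{-# OPTIONS --safe #-}
-- Since b_n = a_n + (n + ℓ + 1), the sequence b lies above a and increases in steps
-- of at least 2. As a_n is the mex of everything produced before it, every number in
-- (ℓ, a_n) is already some a_i or b_i, which gives the partition. If a_{n+1} exceeded
-- a_n + 2, then a_n + 1 and a_n + 2 would both be values of b, which is impossible.
module Submission where

open import Defs
open import Data.Nat
  using (ℕ; zero; suc; _+_; _*_; _∸_; _≤_; _<_; _≤′_; ≤′-refl; ≤′-step
        ; z≤n; s≤s; s≤s⁻¹; z<s)
open import Data.Nat.Properties
open import Data.Nat.Tactic.RingSolver using (solve)
open import Data.List using (_∷_; [])
open import Data.Product using (Σ; _×_; ∃; ∃-syntax; _,_; proj₁; proj₂)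
open import Data.Sum using (_⊎_; inj₁; inj₂)
import Data.Sum as Sum
open import Function using (_∘_)
open import Relation.Nullary using (¬_; yes; no; contradiction)
open import Relation.Binary.PropositionalEquality
  using (_≡_; _≢_; refl; sym; trans; cong; cong₂; subst; module ≡-Reasoning)
open ≡-Reasoning

step-mono-≤ : (f : ℕ → ℕ) → (∀ k → f k ≤ f (suc k)) → ∀ {i j} → i ≤ j → f i ≤ f j
step-mono-≤ f f-step = mono′ ∘ ≤⇒≤′
  where
  mono′ : ∀ {i j} → i ≤′ j → f i ≤ f j
  mono′ ≤′-refl = ≤-refl
  mono′ (≤′-step i≤′j) = ≤-trans (mono′ i≤′j) (f-step _)

n≤f[n] : (f : ℕ → ℕ) → (∀ k → f k < f (suc k)) → ∀ n → n ≤ f n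
n≤f[n] f f-step zero = z≤n
n≤f[n] f f-step (suc n) = ≤-<-trans (n≤f[n] f f-step n) (f-step n)

0<n≤2⇒n≡1∨n≡2 : ∀ {n} → 0 < n → n ≤ 2 → n ≡ 1 ⊎ n ≡ 2
0<n≤2⇒n≡1∨n≡2 {1} _ _ = inj₁ refl
0<n≤2⇒n≡1∨n≡2 {2} _ _ = inj₂ refl
0<n≤2⇒n≡1∨n≡2 {suc (suc (suc _))} _ (s≤s (s≤s ()))

[1+o+n]∸[o+m]≡[n∸m]+1 : ∀ o {m n} → m ≤ n → suc o + n ∸ (o + m) ≡ n ∸ m + 1
[1+o+n]∸[o+m]≡[n∸m]+1 o {m} {n} m≤n = begin
  suc o + n ∸ (o + m)  ≡⟨ cong (_∸ (o + m)) (sym (+-suc o n)) ⟩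
  o + suc n ∸ (o + m)  ≡⟨ [m+n]∸[m+o]≡n∸o o (suc n) m ⟩
  suc n ∸ m            ≡⟨ +-∸-assoc 1 m≤n ⟩
  suc (n ∸ m)          ≡⟨ +-comm 1 (n ∸ m) ⟩
  n ∸ m + 1            ∎

mex-above : ∀ {S m x} → IsMex S m → (∀ k → k ≤ x → S k) → x < m
mex-above (m∉S , _) ≤x⊆S = ≰⇒> (m∉S ∘ ≤x⊆S _)

Prev-mono : ∀ {ℓ a b n n′ m} → n ≤ n′ → Prev ℓ a b n m → Prev ℓ a b n′ m
Prev-mono n≤n′ (inj₁ (i , i<n , m∈aᵢbᵢ)) = inj₁ (i , <-≤-trans i<n n≤n′ , m∈aᵢbᵢ)
Prev-mono n≤n′ (inj₂ m≤ℓ) = inj₂ m≤ℓ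

module Sequence (ℓ : ℕ) (a b : ℕ → ℕ)
  (a₀ : a 0 ≡ ℓ + 1) (b₀ : b 0 ≡ 2 * ℓ + 2)
  (a-mex : ∀ n → IsMex (Prev ℓ a b (suc n)) (a (suc n)))
  (b-def : ∀ n → b (suc n) ≡ a (suc n) + suc n + ℓ + 1) where

  a₀≡1+ℓ : a 0 ≡ suc ℓ
  a₀≡1+ℓ = trans a₀ (+-comm ℓ 1)

  -- Prev ℓ a b 0 = {0, …, ℓ}, so a₀ = ℓ + 1 obeys the mex recursion as well.
  a-isMex : ∀ n → IsMex (Prev ℓ a b n) (a n)
  a-isMex zero rewrite a₀≡1+ℓ = 1+ℓ∉Prev₀ , λ _ k<1+ℓ → inj₂ (s≤s⁻¹ k<1+ℓ)
    where
    1+ℓ∉Prev₀ : ¬ Prev ℓ a b 0 (suc ℓ)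
    1+ℓ∉Prev₀ (inj₁ (_ , () , _))
    1+ℓ∉Prev₀ (inj₂ 1+ℓ≤ℓ) = n≮n ℓ 1+ℓ≤ℓ
  a-isMex (suc n) = a-mex n

  <a⇒Prev : ∀ {n k} → k < a n → Prev ℓ a b (suc n) k
  <a⇒Prev {n} k<aₙ = Prev-mono (n≤1+n n) (proj₂ (a-isMex n) _ k<aₙ)

  ≤a⇒Prev : ∀ {n k} → k ≤ a n → Prev ℓ a b (suc n) k
  ≤a⇒Prev {n} k≤aₙ with m≤n⇒m<n∨m≡n k≤aₙ
  ... | inj₁ k<aₙ = <a⇒Prev k<aₙ
  ... | inj₂ refl = inj₁ (n , n<1+n n , inj₁ refl)

  a-increasing : ∀ n → a n < a (suc n)
  a-increasing n = mex-above (a-mex n) (λ _ → ≤a⇒Prev)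

  a-mono-≤ : ∀ {i j} → i ≤ j → a i ≤ a j
  a-mono-≤ = step-mono-≤ a (<⇒≤ ∘ a-increasing)

  ℓ<a : ∀ n → ℓ < a n
  ℓ<a n = mex-above (a-isMex n) (λ _ → inj₂)

  b≡offset+a : ∀ n → b n ≡ n + suc ℓ + a n
  b≡offset+a zero = begin
    b 0            ≡⟨ b₀ ⟩
    2 * ℓ + 2      ≡⟨ solve (ℓ ∷ []) ⟩
    suc ℓ + suc ℓ  ≡⟨ cong (suc ℓ +_) (sym a₀≡1+ℓ) ⟩
    suc ℓ + a 0    ∎
  b≡offset+a (suc n) = trans (b-def n) (reorder (a (suc n)) (suc n))
    where
    reorder : ∀ x m → x + m + ℓ + 1 ≡ m + suc ℓ + x
    reorder x m = solve (x ∷ m ∷ ℓ ∷ [])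

  b∸a≡offset : ∀ n → b n ∸ a n ≡ n + suc ℓ
  b∸a≡offset n = trans (cong (_∸ a n) (b≡offset+a n)) (m+n∸n≡m (n + suc ℓ) (a n))

  a<b : ∀ n → a n < b n
  a<b n rewrite b≡offset+a n = m<n+m (a n) (<-≤-trans z<s (m≤n+m (suc ℓ) n))

  1+b<b′ : ∀ n → suc (b n) < b (suc n)
  1+b<b′ n rewrite b≡offset+a n | b≡offset+a (suc n) =
    s≤s (+-monoʳ-< (n + suc ℓ) (a-increasing n))

  b-increasing : ∀ n → b n < b (suc n)
  b-increasing n = <-trans (n<1+n (b n)) (1+b<b′ n)

  b-mono-≤ : ∀ {i j} → i ≤ j → b i ≤ b j
  b-mono-≤ = step-mono-≤ b (<⇒≤ ∘ b-increasing)

  1+b≢b : ∀ i j → suc (b i) ≢ b j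
  1+b≢b i j 1+bᵢ≡bⱼ with j ≤? i
  ... | yes j≤i = <-irrefl (sym 1+bᵢ≡bⱼ) (s≤s (b-mono-≤ j≤i))
  ... | no j≰i = <-irrefl 1+bᵢ≡bⱼ (<-≤-trans (1+b<b′ i) (b-mono-≤ (≰⇒> j≰i)))

  a≢b : ∀ n k → a n ≢ b k
  a≢b n k aₙ≡bₖ with n ≤? k
  ... | yes n≤k = <-irrefl aₙ≡bₖ (≤-<-trans (a-mono-≤ n≤k) (a<b k))
  ... | no n≰k = proj₁ (a-isMex n) (subst (Prev ℓ a b n) (sym aₙ≡bₖ) bₖ∈Prevₙ)
    where
    bₖ∈Prevₙ : Prev ℓ a b n (b k)
    bₖ∈Prevₙ = inj₁ (k , ≰⇒> n≰k , inj₂ refl)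

  a-b-cover : ∀ m → ℓ < m → (∃[ n ] a n ≡ m) ⊎ (∃[ n ] b n ≡ m)
  a-b-cover m ℓ<m with proj₂ (a-isMex (suc m)) m (n≤f[n] a a-increasing (suc m))
  ... | inj₁ (i , _ , inj₁ m≡aᵢ) = inj₁ (i , sym m≡aᵢ)
  ... | inj₁ (i , _ , inj₂ m≡bᵢ) = inj₂ (i , sym m≡bᵢ)
  ... | inj₂ m≤ℓ = contradiction m≤ℓ (<⇒≱ ℓ<m)

  offset-unique : ∀ j → ℓ < j → Σ ℕ λ n → j ≡ b n ∸ a n × (∀ n′ → j ≡ b n′ ∸ a n′ → n′ ≡ n)
  offset-unique j ℓ<j =
    j ∸ suc ℓ , sym (trans (b∸a≡offset (j ∸ suc ℓ)) j∸[1+ℓ]+[1+ℓ]≡j) , unique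
    where
    j∸[1+ℓ]+[1+ℓ]≡j : j ∸ suc ℓ + suc ℓ ≡ j
    j∸[1+ℓ]+[1+ℓ]≡j = m∸n+n≡m ℓ<j
    unique : ∀ n′ → j ≡ b n′ ∸ a n′ → n′ ≡ j ∸ suc ℓ
    unique n′ j≡b∸a = +-cancelʳ-≡ (suc ℓ) n′ (j ∸ suc ℓ)
      (trans (sym (b∸a≡offset n′)) (trans (sym j≡b∸a) (sym j∸[1+ℓ]+[1+ℓ]≡j)))

  Prev-above-a : ∀ {n x} → a n < x → Prev ℓ a b (suc n) x → ∃[ i ] b i ≡ x
  Prev-above-a {n} aₙ<x (inj₂ x≤ℓ) = contradiction (<-trans (ℓ<a n) aₙ<x) (≤⇒≯ x≤ℓ)
  Prev-above-a aₙ<x (inj₁ (i , i<1+n , inj₁ refl)) =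
    contradiction aₙ<x (≤⇒≯ (a-mono-≤ (s≤s⁻¹ i<1+n)))
  Prev-above-a _ (inj₁ (i , _ , inj₂ x≡bᵢ)) = i , sym x≡bᵢ

  a′≤a+2 : ∀ n → a (suc n) ≤ a n + 2
  a′≤a+2 n = ≮⇒≥ λ a+2<a′ →
    let a+1<a+2 = +-monoʳ-< (a n) (n<1+n 1)
        i , bᵢ≡a+1 = Prev-above-a (m<m+n (a n) z<s) (below-a′ (<-trans a+1<a+2 a+2<a′))
        j , bⱼ≡a+2 = Prev-above-a (m<m+n (a n) z<s) (below-a′ a+2<a′)
    in 1+b≢b i j (trans (cong suc bᵢ≡a+1) (trans (sym (+-suc (a n) 1)) (sym bⱼ≡a+2)))
    where
    below-a′ : ∀ {x} → x < a (suc n) → Prev ℓ a b (suc n) x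
    below-a′ = proj₂ (a-mex n) _

  a-gap : ∀ n → a (suc n) ∸ a n ≡ 1 ⊎ a (suc n) ∸ a n ≡ 2
  a-gap n = 0<n≤2⇒n≡1∨n≡2 (m<n⇒0<n∸m (a-increasing n)) (m≤n+o⇒m∸n≤o _ (a n) (a′≤a+2 n))

  b-gap≡a-gap+1 : ∀ n → b (suc n) ∸ b n ≡ a (suc n) ∸ a n + 1
  b-gap≡a-gap+1 n = begin
    b (suc n) ∸ b n
      ≡⟨ cong₂ _∸_ (b≡offset+a (suc n)) (b≡offset+a n) ⟩
    suc (n + suc ℓ) + a (suc n) ∸ (n + suc ℓ + a n)
      ≡⟨ [1+o+n]∸[o+m]≡[n∸m]+1 (n + suc ℓ) (<⇒≤ (a-increasing n)) ⟩
    a (suc n) ∸ a n + 1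
      ∎

  b-gap : ∀ n → b (suc n) ∸ b n ≡ 2 ⊎ b (suc n) ∸ b n ≡ 3
  b-gap n = Sum.map shift shift (a-gap n)
    where
    shift : ∀ {d} → a (suc n) ∸ a n ≡ d → b (suc n) ∸ b n ≡ d + 1
    shift a-gap≡d = trans (b-gap≡a-gap+1 n) (cong (_+ 1) a-gap≡d)

lemma18 : (ℓ : ℕ) → 1 ≤ ℓ → (a b : ℕ → ℕ) → IsSeq ℓ a b →
  -- (1) strictly increasing
  ((∀ n → a n < a (suc n)) × (∀ n → b n < b (suc n))) ×
  -- (2) {a_n} and {b_n} partition {m : m > ℓ}
  (((∀ n → ℓ < a n) × (∀ n → ℓ < b n)) ×
   (∀ n k → a n ≢ b k) ×
   (∀ m → ℓ < m → (∃[ n ] a n ≡ m) ⊎ (∃[ n ] b n ≡ m))) ×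
  -- (3) each j > ℓ is b_n - a_n for a unique n
  (∀ j → ℓ < j → Σ ℕ λ n → j ≡ b n ∸ a n × (∀ n′ → j ≡ b n′ ∸ a n′ → n′ ≡ n)) ×
  -- (4) gaps
  (∀ n → (a (suc n) ∸ a n ≡ 1 ⊎ a (suc n) ∸ a n ≡ 2) ×
         (b (suc n) ∸ b n ≡ 2 ⊎ b (suc n) ∸ b n ≡ 3) ×
         (b (suc n) ∸ b n ≡ (a (suc n) ∸ a n) + 1))
lemma18 ℓ _ a b (a₀ , b₀ , a-mex , b-def) =
  (a-increasing , b-increasing) ,
  ((ℓ<a , λ n → <-trans (ℓ<a n) (a<b n)) , a≢b , a-b-cover) ,
  offset-unique ,
  (λ n → a-gap n , b-gap n , b-gap≡a-gap+1 n)
  where open Sequence ℓ a b a₀ b₀ a-mex b-def
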